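{- Let $k > \ell \geq 1$ be integers, let $i = i(k,\ell)$, and let $e_1,\dots,e_t$ be positive integers. Then \[ R_<\big(P_{e_1}^{k,\ell}, \dots, P_{e_t}^{k,\ell}\big) = (k-\ell)\,R_<\big(P_{e_1}^{i,i-1}, \dots, P_{e_t}^{i,i-1}\big) + \ell - (k-\ell)(i-1). \]
   Context: An ordered $k$-uniform hypergraph is a $k$-uniform hypergraph with a totally ordered vertex set. An ordered hypergraph $G$ is contained in an ordered hypergraph $H$ if there is an injective order-preserving map $V(G)\to V(H)$ sending every edge of $G$ to an edge of $H$. $K_N^k$ is the complete $k$-uniform hypergraph on $[N]=\{1,\dots,N\}$ with the natural order. For ordered $k$-uniform hypergraphs $G_1,\dots,G_t$, the ordered Ramsey number $R_<(G_1,\dots,G_t)$ is the least $N$ such that for every coloring $c:E(K_N^k)\to[t]$ there is a color $j$ such that the hypergraph formed by the edges of color $j$ contains $G_j$. For integers $k>\ell\ge 0$ and $e\ge1$, the path $P_e^{k,\ell}$ is the ordered $k$-uniform hypergraph on vertex set $[e(k-\ell)+\ell]$ with edges $A_r=\{(r-1)(k-\ell)+1,\dots,(r-1)(k-\ell)+k\}$ for $r=1,\dots,e$ (so consecutive edges share exactly $\ell$ vertices: the $\ell$ largest of $A_r$ and the $\ell$ smallest of $A_{r+1}$). For $k>\ell\ge1$, the intersection number $i(k,\ell)$ is the unique integer $m\ge2$ with $\frac{m-2}{m-1}<\frac{\ell}{k}\le\frac{m-1}{m}$. -}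

module Defs where

open import Data.Nat using (ℕ; _+_; _*_; _∸_; _≤_; _<_)
open import Data.Fin using (Fin; toℕ) renaming (_<_ to _<ᶠ_)
open import Data.Vec using (Vec; map; tabulate)
open import Data.Vec.Relation.Unary.Linked using (Linked)
open import Data.Product using (Σ; _×_; ∃)
open import Relation.Binary.PropositionalEquality using (_≡_)

-- An edge is
-- represented by the strictly increasing listing of its k vertices.
record OrdHypergraph (k : ℕ) : Set₁ where
  field
    nV   : ℕ
    Edge : Vec (Fin nV) k → Set
open OrdHypergraph public

Increasing : ∀ {N k} → Vec (Fin N) k → Set
Increasing = Linked _<ᶠ_

Colouring : ℕ → ℕ → ℕ → Set
Colouring k N t = (v : Vec (Fin N) k) → Increasing v → Fin t

OrderEmbedding : ℕ → ℕ → Set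
OrderEmbedding m N = Σ (Fin m → Fin N) λ f → ∀ a b → a <ᶠ b → f a <ᶠ f b

ContainedInColour : ∀ {k N t} → OrdHypergraph k → Colouring k N t → Fin t → Set
ContainedInColour {k} {N} G c j =
  Σ (OrderEmbedding (nV G) N) λ f →
    ∀ (v : Vec (Fin (nV G)) k) → Edge G v →
      ∀ (p : Increasing (map (Data.Product.proj₁ f) v)) → c (map (Data.Product.proj₁ f) v) p ≡ j

Arrows : ∀ {k t} → ℕ → (Fin t → OrdHypergraph k) → Set
Arrows {k} {t} N Gs = (c : Colouring k N t) → ∃ λ j → ContainedInColour (Gs j) c j

IsOrderedRamseyNumber : ∀ {k t} → (Fin t → OrdHypergraph k) → ℕ → Set
IsOrderedRamseyNumber Gs N = Arrows N Gs × (∀ M → Arrows M Gs → N ≤ M)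

-- The path P_e^{k,ℓ}: vertex set [e(k-ℓ)+ℓ]; using 0-based vertices
-- (vertex x ↔ toℕ x + 1), edge A_r (r = 1..e) is
-- {(r-1)(k-ℓ), ..., (r-1)(k-ℓ)+k-1}, listed increasingly.
Path : (k ℓ e : ℕ) → OrdHypergraph k
Path k ℓ e = record
  { nV   = e * (k ∸ ℓ) + ℓ
  ; Edge = λ v → Σ ℕ λ r → r < e ×
                 (map toℕ v ≡ tabulate (λ a → r * (k ∸ ℓ) + toℕ a))
  }

-- i is the intersection number i(k,ℓ): m ≥ 2 and
-- (m-2)/(m-1) < ℓ/k ≤ (m-1)/m, written with cleared denominators.
IsIntersectionNumber : ℕ → ℕ → ℕ → Set
IsIntersectionNumber k ℓ m =
  2 ≤ m × ((m ∸ 2) * k < ℓ * (m ∸ 1)) × (ℓ * m ≤ (m ∸ 1) * k)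

module Submission where

-- Let d = k - ℓ and i = i(k,ℓ) = w + 1.  The inequalities defining i say
-- exactly that k = w d + s with 1 ≤ s ≤ d.  Blowing every vertex of the tight
-- path P_e^{w+1,w} up to a block of d consecutive vertices (cutting the last
-- block after s of them) gives P_e^{k,ℓ}; keeping every d-th vertex of
-- P_e^{k,ℓ} and dividing by d gives back the tight path.  Pulling colourings
-- back along these maps shows that if R + 1 arrows the tight paths then R d + s
-- arrows the paths P^{k,ℓ}, and if M arrows the paths P^{k,ℓ} then
-- (M - s)/d + 1 arrows the tight paths.  Hence R_<(P^{k,ℓ}) = d (R_<(P^{i,i-1}) - 1) + s,
-- which is the stated formula.
--
-- The proof is constructive, so the Ramsey numbers must be produced: we prove
-- Ramsey's theorem for ordered tight paths by induction on the uniformity,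
-- decide the arrow relation by exhaustive search and take the least arrowing
-- number.

open import Defs
open import Data.Nat using (ℕ; zero; suc; _+_; _*_; _∸_; _^_; _≤_; _<_; z≤n; s≤s; s≤s⁻¹; z<s; s<s; _<?_; _≤?_; NonZero; >-nonZero; anyUpTo?; allUpTo?)
open import Data.Nat.Properties
open import Data.Nat.DivMod
open import Data.Nat.Divisibility using (n∣m*n)
open import Data.Nat.Induction using (<-rec)
open import Data.Nat.Solver using (module +-*-Solver)
open import Data.Fin using (Fin; toℕ; fromℕ<; combine; remQuot; funToFin; finToFun) renaming (zero to fzero; suc to fsuc; _<_ to _<ᶠ_)
import Data.Fin.Properties as FP
open import Data.Vec using (Vec; []; _∷_; map; tabulate; lookup)
import Data.Vec.Properties as VP
open import Data.Vec.Relation.Unary.Linked as Linked using ([]; [-]; _∷_; linked?)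
open import Data.Product using (Σ; _×_; _,_; proj₁; proj₂)
open import Data.Sum using (inj₁; inj₂)
open import Data.Unit using (⊤; tt)
open import Data.Empty using (⊥; ⊥-elim)
open import Relation.Nullary using (Dec; yes; no; ¬?)
open import Relation.Nullary.Decidable using (_×-dec_; _→-dec_; map′; decidable-stable)
open import Relation.Binary.PropositionalEquality using (_≡_; refl; sym; trans; cong; cong₂; subst; subst₂; module ≡-Reasoning)
open import Function using (_∘_)

-- An increasing K-tuple of vertices of [N] is handled as a function
-- f : ℕ → ℕ whose first K values increase and stay below N; shifting a
-- window along a path or rescaling vertices then becomes arithmetic on f.
IncreasingOn : ℕ → (ℕ → ℕ) → Set
IncreasingOn n f = ∀ a → suc a < n → f a < f (suc a)

BoundedOn : ℕ → ℕ → (ℕ → ℕ) → Set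
BoundedOn n N f = ∀ a → a < n → f a < N

AgreeOn : ℕ → (ℕ → ℕ) → (ℕ → ℕ) → Set
AgreeOn n f g = ∀ a → a < n → f a ≡ g a

tuple : ∀ {N} K (f : ℕ → ℕ) → BoundedOn K N f → Vec (Fin N) K
tuple zero    f q = []
tuple (suc K) f q = fromℕ< (q 0 z<s) ∷ tuple K (f ∘ suc) (λ a a<K → q (suc a) (s<s a<K))

entries : ∀ {N K} → Vec (Fin N) K → ℕ → ℕ
entries []      a       = 0
entries (x ∷ v) zero    = toℕ x
entries (x ∷ v) (suc a) = entries v a

tuple-increasing : ∀ {N} K f (p : IncreasingOn K f) (q : BoundedOn K N f) → Increasing (tuple K f q)
tuple-increasing zero          f p q = []
tuple-increasing (suc zero)    f p q = [-]
tuple-increasing (suc (suc K)) f p q =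
  subst₂ _<_ (sym (FP.toℕ-fromℕ< (q 0 z<s))) (sym (FP.toℕ-fromℕ< (q 1 (s<s z<s)))) (p 0 (s<s (s<s z≤n)))
  ∷ tuple-increasing (suc K) (f ∘ suc) (λ a h → p (suc a) (s<s h)) (λ a a<K → q (suc a) (s<s a<K))

entries-increasing : ∀ {N K} {v : Vec (Fin N) K} → Increasing v → IncreasingOn K (entries v)
entries-increasing [-] zero (s<s ())
entries-increasing [-] (suc a) (s<s ())
entries-increasing {v = x ∷ y ∷ v} (x<y ∷ p) zero    h       = x<y
entries-increasing {v = x ∷ y ∷ v} (x<y ∷ p) (suc a) (s<s h) = entries-increasing p a h

entries-bounded : ∀ {N K} (v : Vec (Fin N) K) → BoundedOn K N (entries v)
entries-bounded (x ∷ v) zero    h       = FP.toℕ<n x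
entries-bounded (x ∷ v) (suc a) (s<s h) = entries-bounded v a h

entries-tuple : ∀ {N} K f (q : BoundedOn K N f) → AgreeOn K (entries (tuple K f q)) f
entries-tuple (suc K) f q zero    h       = FP.toℕ-fromℕ< (q 0 z<s)
entries-tuple (suc K) f q (suc a) (s<s h) = entries-tuple K (f ∘ suc) _ a h

tuple-cong : ∀ {N} K f g (q : BoundedOn K N f) (q' : BoundedOn K N g) → AgreeOn K f g → tuple K f q ≡ tuple K g q'
tuple-cong zero    f g q q' f≈g = refl
tuple-cong (suc K) f g q q' f≈g =
  cong₂ _∷_ (FP.fromℕ<-cong _ _ (f≈g 0 z<s) _ _)
    (tuple-cong K (f ∘ suc) (g ∘ suc) _ _ (λ a h → f≈g (suc a) (s<s h)))

tuple-entries : ∀ {N K} (v : Vec (Fin N) K) (q : BoundedOn K N (entries v)) → tuple K (entries v) q ≡ v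
tuple-entries []      q = refl
tuple-entries (x ∷ v) q = cong₂ _∷_ (FP.fromℕ<-toℕ x _) (tuple-entries v _)

tuple-unique : ∀ {N K} (v : Vec (Fin N) K) g → AgreeOn K (entries v) g → (q : BoundedOn K N g) → v ≡ tuple K g q
tuple-unique {K = K} v g v≈g q = trans (sym (tuple-entries v (entries-bounded v))) (tuple-cong K (entries v) g _ q v≈g)

toℕ-tuple : ∀ {N} K f (q : BoundedOn K N f) → map toℕ (tuple K f q) ≡ tabulate (f ∘ toℕ)
toℕ-tuple zero    f q = refl
toℕ-tuple (suc K) f q = cong₂ _∷_ (FP.toℕ-fromℕ< _) (toℕ-tuple K (f ∘ suc) _)

entries-map : ∀ {n M K} (F : Fin n → Fin M) (G : ℕ → ℕ) → (∀ x → toℕ (F x) ≡ G (toℕ x)) →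
  (v : Vec (Fin n) K) → AgreeOn K (entries (map F v)) (G ∘ entries v)
entries-map F G F≈G (x ∷ v) zero    h       = F≈G x
entries-map F G F≈G (x ∷ v) (suc a) (s<s h) = entries-map F G F≈G v a h

entries-interval : ∀ {n K} (v : Vec (Fin n) K) s → map toℕ v ≡ tabulate (λ a → s + toℕ a) →
  AgreeOn K (entries v) (s +_)
entries-interval (x ∷ v) s eq zero    h       = VP.∷-injectiveˡ eq
entries-interval (x ∷ v) s eq (suc a) (s<s h) =
  trans (entries-interval v (suc s) eq' a h) (sym (+-suc s a))
  where
  eq' : map toℕ v ≡ tabulate (λ a → suc s + toℕ a)
  eq' = trans (VP.∷-injectiveʳ eq) (VP.tabulate-cong (λ b → +-suc s (toℕ b)))

colour-resp : ∀ {K N t} (c : Colouring K N t) {v v' : Vec (Fin N) K} → v ≡ v' →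
  (p : Increasing v) (p' : Increasing v') → c v p ≡ c v' p'
colour-resp c refl p p' = cong (c _) (Linked.irrelevant FP.<-irrelevant p p')

colourOf : ∀ {K N t} (c : Colouring K N t) (f : ℕ → ℕ) → IncreasingOn K f → BoundedOn K N f → Fin t
colourOf {K} c f p q = c (tuple K f q) (tuple-increasing K f p q)

colourOf-cong : ∀ {K N t} (c : Colouring K N t) f g p q p' q' → AgreeOn K f g → colourOf c f p q ≡ colourOf c g p' q'
colourOf-cong {K} c f g p q p' q' f≈g = colour-resp c (tuple-cong K f g q q' f≈g) _ _

colour-entries : ∀ {K N t} (c : Colouring K N t) (v : Vec (Fin N) K) (p : Increasing v) →
  c v p ≡ colourOf c (entries v) (entries-increasing p) (entries-bounded v)
colour-entries c v p = colour-resp c (sym (tuple-entries v _)) _ _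

increasing-cong : ∀ {n f g} → AgreeOn n f g → IncreasingOn n f → IncreasingOn n g
increasing-cong f≈g I a h = subst₂ _<_ (f≈g a (<-trans (n<1+n a) h)) (f≈g (suc a) h) (I a h)

bounded-cong : ∀ {n N f g} → AgreeOn n f g → BoundedOn n N f → BoundedOn n N g
bounded-cong f≈g B a h = subst (_< _) (f≈g a h) (B a h)

increasing-< : ∀ {n g} → IncreasingOn n g → ∀ a b → a < b → b < n → g a < g b
increasing-< {n} {g} I a (suc b) (s≤s a≤b) b<n with m≤n⇒m<n∨m≡n a≤b
... | inj₁ a<b  = <-trans (increasing-< I a b a<b (<-trans (n<1+n b) b<n)) (I b b<n)
... | inj₂ refl = I a b<n

increasing-≤ : ∀ {n g} → IncreasingOn n g → ∀ a b → a ≤ b → b < n → g a ≤ g b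
increasing-≤ I a b a≤b b<n with m≤n⇒m<n∨m≡n a≤b
... | inj₁ a<b  = <⇒≤ (increasing-< I a b a<b b<n)
... | inj₂ refl = ≤-refl

increasing-gap : ∀ {n g} → IncreasingOn n g → ∀ a b → a + b < n → g a + b ≤ g (a + b)
increasing-gap {g = g} I a zero h rewrite +-identityʳ a | +-identityʳ (g a) = ≤-refl
increasing-gap {g = g} I a (suc b) h rewrite +-suc (g a) b | +-suc a b =
  ≤-trans (s≤s (increasing-gap I a b (<-trans (n<1+n _) h))) (I (a + b) h)

increasing-length : ∀ {K M g} → IncreasingOn K g → BoundedOn K M g → K ≤ M
increasing-length {zero}      I B = z≤n
increasing-length {suc K} {M} {g} I B =
  ≤-trans (s≤s (≤-trans (m≤n+m K (g 0)) (increasing-gap I 0 K (n<1+n K)))) (B K (n<1+n K))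

shift-increasing : ∀ {n g} o K → IncreasingOn n g → o + K ≤ n → IncreasingOn K (λ a → g (o + a))
shift-increasing {n} {g} o K I h a sa<K = subst (λ z → g (o + a) < g z) (sym (+-suc o a)) (I (o + a) fits)
  where
  fits : suc (o + a) < n
  fits = subst (_≤ n) (trans (+-suc o (suc a)) (cong suc (+-suc o a))) (≤-trans (+-monoʳ-≤ o sa<K) h)

shift-bounded : ∀ {n N g} o K → BoundedOn n N g → o + K ≤ n → BoundedOn K N (λ a → g (o + a))
shift-bounded o K B h a a<K = B (o + a) (<-≤-trans (+-monoʳ-< o a<K) h)

-- A vertex map Fin n → Fin M, read as a function on ℕ (0 beyond n).
extend : ∀ {n M} → (Fin n → Fin M) → ℕ → ℕ
extend {n} F b with b <? n
... | yes h = toℕ (F (fromℕ< h))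
... | no _  = 0

extend-toℕ : ∀ {n M} (F : Fin n → Fin M) y → extend F (toℕ y) ≡ toℕ (F y)
extend-toℕ {n} F y with toℕ y <? n
... | yes h  = cong (λ z → toℕ (F z)) (FP.fromℕ<-toℕ y h)
... | no ¬h  = ⊥-elim (¬h (FP.toℕ<n y))

extend-< : ∀ {n M} (F : Fin n → Fin M) b (h : b < n) → extend F b ≡ toℕ (F (fromℕ< h))
extend-< F b h = trans (cong (extend F) (sym (FP.toℕ-fromℕ< h))) (extend-toℕ F (fromℕ< h))

extend-increasing : ∀ {n M} (F : Fin n → Fin M) → (∀ a b → a <ᶠ b → F a <ᶠ F b) → IncreasingOn n (extend F)
extend-increasing F mono a h = subst₂ _<_ (sym (extend-< F a (<-trans (n<1+n a) h))) (sym (extend-< F (suc a) h))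
  (mono _ _ (subst₂ _<_ (sym (FP.toℕ-fromℕ< (<-trans (n<1+n a) h))) (sym (FP.toℕ-fromℕ< h)) (n<1+n a)))

extend-bounded : ∀ {n M} (F : Fin n → Fin M) → BoundedOn n M (extend F)
extend-bounded F a h = subst (_< _) (sym (extend-< F a h)) (FP.toℕ<n _)

embed : ∀ {n N P} → BoundedOn n N P → Fin n → Fin N
embed {P = P} B x = fromℕ< (B (toℕ x) (FP.toℕ<n x))

toℕ-embed : ∀ {n N P} (B : BoundedOn n N P) x → toℕ (embed B x) ≡ P (toℕ x)
toℕ-embed B x = FP.toℕ-fromℕ< _

embed-mono : ∀ {n N P} (I : IncreasingOn n P) (B : BoundedOn n N P) → ∀ a b → a <ᶠ b → embed B a <ᶠ embed B b
embed-mono I B a b a<b = subst₂ _<_ (sym (toℕ-embed B a)) (sym (toℕ-embed B b))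
  (increasing-< I (toℕ a) (toℕ b) a<b (FP.toℕ<n b))

MonoPath : ∀ {k N t} (c : Colouring k N t) (j : Fin t) (ℓ e : ℕ) (P : ℕ → ℕ) → Set
MonoPath {k} {N} c j ℓ e P = IncreasingOn (e * (k ∸ ℓ) + ℓ) P × BoundedOn (e * (k ∸ ℓ) + ℓ) N P ×
  (∀ r → r < e → ∀ p q → colourOf c (λ a → P (r * (k ∸ ℓ) + a)) p q ≡ j)

edge-fits : ∀ {k ℓ e r} → ℓ ≤ k → r < e → r * (k ∸ ℓ) + k ≤ e * (k ∸ ℓ) + ℓ
edge-fits {k} {ℓ} {e} {r} ℓ≤k r<e = begin
  r * (k ∸ ℓ) + k              ≡⟨ cong (r * (k ∸ ℓ) +_) (sym (m∸n+n≡m ℓ≤k)) ⟩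
  r * (k ∸ ℓ) + (k ∸ ℓ + ℓ)    ≡⟨ sym (+-assoc (r * (k ∸ ℓ)) (k ∸ ℓ) ℓ) ⟩
  r * (k ∸ ℓ) + (k ∸ ℓ) + ℓ    ≡⟨ cong (_+ ℓ) (+-comm (r * (k ∸ ℓ)) (k ∸ ℓ)) ⟩
  suc r * (k ∸ ℓ) + ℓ          ≤⟨ +-monoˡ-≤ ℓ (*-monoˡ-≤ (k ∸ ℓ) r<e) ⟩
  e * (k ∸ ℓ) + ℓ              ∎
  where open ≤-Reasoning

edge-image : ∀ {n N K} (F : Fin n → Fin N) g → (∀ x → toℕ (F x) ≡ g (toℕ x)) →
  (v : Vec (Fin n) K) (s : ℕ) → map toℕ v ≡ tabulate (λ a → s + toℕ a) →
  AgreeOn K (entries (map F v)) (λ a → g (s + a))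
edge-image F g F≈g v s eq a h = trans (entries-map F g F≈g v a h) (cong g (entries-interval v s eq a h))

monoPath⇒contained : ∀ {k N t} (c : Colouring k N t) j ℓ e P → MonoPath c j ℓ e P → ContainedInColour (Path k ℓ e) c j
monoPath⇒contained {k} c j ℓ e P (I , B , W) = (embed B , embed-mono I B) , inner
  where
  inner : ∀ v → Edge (Path k ℓ e) v → ∀ p → c (map (embed B) v) p ≡ j
  inner v (r , r<e , eq) p = trans (colour-entries c _ p) (trans (colourOf-cong c _ _ _ _ I' B' window) (W r r<e I' B'))
    where
    window = edge-image (embed B) P (toℕ-embed B) v (r * (k ∸ ℓ)) eq
    I' = increasing-cong window (entries-increasing p)
    B' = bounded-cong window (entries-bounded (map (embed B) v))

contained⇒monoPath : ∀ {k N t} (c : Colouring k N t) j ℓ e → ℓ ≤ k →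
  ContainedInColour (Path k ℓ e) c j → Σ (ℕ → ℕ) (MonoPath c j ℓ e)
contained⇒monoPath {k} c j ℓ e ℓ≤k ((F , mono) , inner) =
  extend F , extend-increasing F mono , extend-bounded F , window
  where
  window : ∀ r → r < e → ∀ p q → colourOf c (λ a → extend F (r * (k ∸ ℓ) + a)) p q ≡ j
  window r r<e p q = trans (colour-resp c image _ edge-increasing) (inner edge (r , r<e , toℕ-tuple k _ _) _)
    where
    edge = tuple k (r * (k ∸ ℓ) +_) (λ a a<k → <-≤-trans (+-monoʳ-< _ a<k) (edge-fits ℓ≤k r<e))
    image : tuple k _ q ≡ map F edge
    image = sym (tuple-unique (map F edge) _
      (λ a h → trans (entries-map F (extend F) (sym ∘ extend-toℕ F) edge a h)
                     (cong (extend F) (entries-tuple k _ _ a h))) q)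
    edge-increasing : Increasing (map F edge)
    edge-increasing = subst Increasing image (tuple-increasing k _ p q)

arrows-size : ∀ {K t} M (Gs : Fin t → OrdHypergraph K) → (∀ j → K ≤ nV (Gs j)) → Arrows M Gs → K ≤ M
arrows-size {K} M Gs large arrows with K ≤? M
... | yes K≤M = K≤M
... | no K≰M with arrows (λ v p → ⊥-elim (K≰M (increasing-length (entries-increasing p) (entries-bounded v))))
...   | j , ((F , mono) , _) = ≤-trans (large j) (increasing-length (extend-increasing F mono) (extend-bounded F))

TightPath : ∀ {w N m} (c : Colouring (suc w) N m) (j : Fin m) (n : ℕ) (P : ℕ → ℕ) → Set
TightPath {w} {N} c j n P = IncreasingOn (n + w) P × BoundedOn (n + w) N P ×
  (∀ r → r < n → ∀ p q → colourOf c (λ a → P (r + a)) p q ≡ j)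

window-fits : ∀ {n w r} → r < n → r + suc w ≤ n + w
window-fits {n} {w} {r} r<n rewrite +-suc r w = +-monoˡ-≤ w r<n

window-increasing : ∀ {n w P r} → IncreasingOn (n + w) P → r < n → IncreasingOn (suc w) (λ a → P (r + a))
window-increasing {w = w} {r = r} I r<n = shift-increasing r (suc w) I (window-fits r<n)

window-bounded : ∀ {n w N P r} → BoundedOn (n + w) N P → r < n → BoundedOn (suc w) N (λ a → P (r + a))
window-bounded {w = w} {r = r} B r<n = shift-bounded r (suc w) B (window-fits r<n)

tightPath-prefix : ∀ {w N m} (c : Colouring (suc w) N m) j e L P → e ≤ L → TightPath c j L P → TightPath c j e P
tightPath-prefix c j e L P e≤L (I , B , W) =
  (λ a h → I a (<-≤-trans h (+-monoˡ-≤ _ e≤L))) ,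
  (λ a h → B a (<-≤-trans h (+-monoˡ-≤ _ e≤L))) ,
  λ r r<e p q → W r (<-≤-trans r<e e≤L) p q

-- The tight path P_e^{w+1,w} has e + w vertices and its edge r starts at
-- vertex r, so its monochromatic copies are exactly the TightPaths.
tight-step : ∀ w → suc w ∸ w ≡ 1
tight-step w = m+n∸n≡m 1 w

tight-size : ∀ e w → e * (suc w ∸ w) + w ≡ e + w
tight-size e w = cong (_+ w) (trans (cong (e *_) (tight-step w)) (*-identityʳ e))

tight-start : ∀ r w → r * (suc w ∸ w) ≡ r
tight-start r w = trans (cong (r *_) (tight-step w)) (*-identityʳ r)

tight-window : ∀ w (P : ℕ → ℕ) r → AgreeOn (suc w) (λ a → P (r + a)) (λ a → P (r * (suc w ∸ w) + a))
tight-window w P r a _ = cong (λ z → P (z + a)) (sym (tight-start r w))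

tightPath⇒monoPath : ∀ {w N m} (c : Colouring (suc w) N m) j e P → TightPath c j e P → MonoPath c j w e P
tightPath⇒monoPath {w} {N} c j e P (I , B , W) =
  subst (λ n → IncreasingOn n P) (sym (tight-size e w)) I ,
  subst (λ n → BoundedOn n N P) (sym (tight-size e w)) B ,
  window
  where
  window : ∀ r → r < e → ∀ p q → colourOf c (λ a → P (r * (suc w ∸ w) + a)) p q ≡ j
  window r r<e p q = trans (colourOf-cong c _ _ p q p' q' (λ a h → sym (tight-window w P r a h))) (W r r<e p' q')
    where
    p' = increasing-cong (λ a h → sym (tight-window w P r a h)) p
    q' = bounded-cong (λ a h → sym (tight-window w P r a h)) q

monoPath⇒tightPath : ∀ {w N m} (c : Colouring (suc w) N m) j e P → MonoPath c j w e P → TightPath c j e P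
monoPath⇒tightPath {w} {N} c j e P (I , B , W) =
  subst (λ n → IncreasingOn n P) (tight-size e w) I ,
  subst (λ n → BoundedOn n N P) (tight-size e w) B ,
  window
  where
  window : ∀ r → r < e → ∀ p q → colourOf c (λ a → P (r + a)) p q ≡ j
  window r r<e p q = trans (colourOf-cong c _ _ p q p' q' (tight-window w P r)) (W r r<e p' q')
    where
    p' = increasing-cong (tight-window w P r) p
    q' = bounded-cong (tight-window w P r) q

TightPathBound : ℕ → ℕ → ℕ → Set
TightPathBound u m L = Σ ℕ λ N → ∀ (c : Colouring (suc u) N m) → Σ (Fin m) λ j → Σ (ℕ → ℕ) λ P → TightPath c j L P

-- Uniformity 1: by pigeonhole, m colours on m+1 vertices repeat on some a < b.
tightPathBound-base : ∀ m → TightPathBound 0 m 2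
tightPathBound-base m = suc m , pair
  where
  pair : (c : Colouring 1 (suc m) m) → Σ (Fin m) λ j → Σ (ℕ → ℕ) λ P → TightPath c j 2 P
  pair c with FP.pigeonhole (n<1+n m) (λ a → c (a ∷ []) [-])
  ... | a , b , a<b , same = c (a ∷ []) [-] , P , I , B , W
    where
    P : ℕ → ℕ
    P zero    = toℕ a
    P (suc _) = toℕ b
    I : IncreasingOn 2 P
    I zero    _ = a<b
    I (suc x) (s≤s (s≤s ()))
    B : BoundedOn 2 (suc m) P
    B zero    _ = FP.toℕ<n a
    B (suc x) _ = FP.toℕ<n b
    W : ∀ r → r < 2 → ∀ p q → colourOf c (λ x → P (r + x)) p q ≡ c (a ∷ []) [-]
    W zero          _ p q = colour-resp c (cong (_∷ []) (FP.fromℕ<-toℕ a _)) _ [-]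
    W (suc zero)    _ p q = trans (colour-resp c (cong (_∷ []) (FP.fromℕ<-toℕ b _)) _ [-]) (sym same)
    W (suc (suc r)) (s≤s (s≤s ()))

decide-bounded : ∀ n N f → Dec (BoundedOn n N f)
decide-bounded n N f = map′ (λ h a a<n → h a<n) (λ B {a} a<n → B a a<n) (allUpTo? (λ a → f a <? N) n)

decide-increasing : ∀ n f → Dec (IncreasingOn n f)
decide-increasing n f = map′ (λ h a sa<n → h (<-trans (n<1+n a) sa<n) sa<n) (λ I {a} _ → I a)
  (allUpTo? (λ a → (suc a <? n) →-dec (f a <? f (suc a))) n)

toBit : ∀ {P : Set} → Dec P → Fin 2
toBit (yes _) = fzero
toBit (no _)  = fsuc fzero

toBit-transfer : ∀ {P Q : Set} (d : Dec P) (d' : Dec Q) → toBit d ≡ toBit d' → P → Q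
toBit-transfer (yes p) (yes q) same _ = q
toBit-transfer (yes p) (no ¬q) ()   _
toBit-transfer (no ¬p) d'      same p = ⊥-elim (¬p p)

prepend : ℕ → (ℕ → ℕ) → ℕ → ℕ
prepend x f zero    = x
prepend x f (suc a) = f a

-- The induction step, from uniformity u+1 (2-edge paths, any number of
-- colours) to uniformity w+1 = u+2 (L-edge paths, m colours).  Colour each
-- w-tuple h by its profile: the set of pairs (j, n), n < L, such that h is
-- the start of a colour-j tight path with n edges.  In a 2-edge tight path
-- P 0 < ... < P w of constant profile, whenever P 0..w-1 starts such a
-- path with n edges so does P 1..w, and prepending P 0 gives n + 1 edges in
-- the colour j of P 0..w; so P 0..w-1 starts a colour-j path with L edges.
module TightPathStep (u : ℕ) (IH : ∀ m' → TightPathBound u m' 2) (m L : ℕ) where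
  w : ℕ
  w = suc u

  N : ℕ
  N = proj₁ (IH (2 ^ (m * L)))

  snoc : (ℕ → ℕ) → ℕ → ℕ → ℕ
  snoc h x a with a <? w
  ... | yes _ = h a
  ... | no _  = x

  snoc-< : ∀ h x a → a < w → snoc h x a ≡ h a
  snoc-< h x a a<w with a <? w
  ... | yes _ = refl
  ... | no ¬p = ⊥-elim (¬p a<w)

  snoc-last : ∀ h x → snoc h x w ≡ x
  snoc-last h x with w <? w
  ... | yes p = ⊥-elim (<-irrefl refl p)
  ... | no _  = refl

  snoc-cong : ∀ h h' x → AgreeOn w h h' → AgreeOn (suc w) (snoc h x) (snoc h' x)
  snoc-cong h h' x h≈h' a a<sw with a <? w
  ... | yes a<w = h≈h' a a<w
  ... | no _    = refl

  module WithColouring (c : Colouring (suc w) N m) where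
    HasColour : Fin m → (ℕ → ℕ) → Set
    HasColour j f = Σ (IncreasingOn (suc w) f) λ p → Σ (BoundedOn (suc w) N f) λ q → colourOf c f p q ≡ j

    decide-HasColour : ∀ j f → Dec (HasColour j f)
    decide-HasColour j f with decide-increasing (suc w) f | decide-bounded (suc w) N f
    ... | no ¬p | _     = no λ { (p , _) → ¬p p }
    ... | yes p | no ¬q = no λ { (_ , q , _) → ¬q q }
    ... | yes p | yes q with colourOf c f p q FP.≟ j
    ...   | yes same = yes (p , q , same)
    ...   | no ¬same = no λ { (p' , q' , same') → ¬same (trans (colourOf-cong c f f p q p' q' (λ _ _ → refl)) same') }

    HasColour-cong : ∀ {j f g} → AgreeOn (suc w) f g → HasColour j f → HasColour j g
    HasColour-cong {j} {f} {g} f≈g (p , q , same) =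
      increasing-cong f≈g p , bounded-cong f≈g q ,
      trans (sym (colourOf-cong c f g p q (increasing-cong f≈g p) (bounded-cong f≈g q) f≈g)) same

    Starts : Fin m → ℕ → (ℕ → ℕ) → Set
    Starts j zero    h = ⊤
    Starts j (suc n) h = Σ ℕ λ x → x < N × HasColour j (snoc h x) × Starts j n (snoc h x ∘ suc)

    decide-Starts : ∀ j n h → Dec (Starts j n h)
    decide-Starts j zero    h = yes tt
    decide-Starts j (suc n) h = anyUpTo? (λ x → decide-HasColour j (snoc h x) ×-dec decide-Starts j n (snoc h x ∘ suc)) N

    Starts-cong : ∀ j n h h' → AgreeOn w h h' → Starts j n h → Starts j n h'
    Starts-cong j zero    h h' h≈h' _ = tt
    Starts-cong j (suc n) h h' h≈h' (x , x<N , coloured , rest) =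
      x , x<N , HasColour-cong (snoc-cong h h' x h≈h') coloured ,
      Starts-cong j n _ _ (λ a a<w → snoc-cong h h' x h≈h' (suc a) (s≤s a<w)) rest

    Starts⇒tightPath : ∀ j n h → IncreasingOn w h → BoundedOn w N h → Starts j n h →
      Σ (ℕ → ℕ) λ P → TightPath c j n P × AgreeOn w P h
    Starts⇒tightPath j zero h I B _ = h , (I , B , λ r ()) , λ _ _ → refl
    Starts⇒tightPath j (suc n) h I B (x , x<N , (pI , pB , coloured) , rest)
      with Starts⇒tightPath j n (snoc h x ∘ suc) (λ a a<w → pI (suc a) (s≤s a<w)) (λ a a<w → pB (suc a) (s≤s a<w)) rest
    ... | P' , (I' , B' , W') , P'≈ = P , (incP , bdP , winP) , P≈h
      where
      P = prepend (h 0) P'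
      first : AgreeOn (suc w) P (snoc h x)
      first zero    _           = sym (snoc-< h x 0 z<s)
      first (suc a) (s≤s a<w) = P'≈ a a<w
      incP : IncreasingOn (suc n + w) P
      incP zero    _       = subst₂ _<_ (snoc-< h x 0 z<s) (sym (P'≈ 0 z<s)) (pI 0 (s≤s (s≤s z≤n)))
      incP (suc a) (s≤s h) = I' a h
      bdP : BoundedOn (suc n + w) N P
      bdP zero    _       = B 0 z<s
      bdP (suc a) (s≤s h) = B' a h
      winP : ∀ r → r < suc n → ∀ p q → colourOf c (λ a → P (r + a)) p q ≡ j
      winP zero    _         p q = trans (colourOf-cong c _ _ p q pI pB first) coloured
      winP (suc r) (s≤s r<n) p q = W' r r<n p q
      P≈h : AgreeOn w P h
      P≈h zero    _    = refl
      P≈h (suc a) sa<w = trans (P'≈ a (<-trans (n<1+n a) sa<w)) (snoc-< h x (suc a) sa<w)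

    -- The profile of a w-tuple, indexed by Fin (m * L) ≅ Fin m × Fin L.
    profile : (ℕ → ℕ) → Fin (m * L) → Fin 2
    profile h z = toBit (decide-Starts (proj₁ (remQuot {m} L z)) (toℕ (proj₂ (remQuot {m} L z))) h)

    profile-at : ∀ h j (n : Fin L) → profile h (combine j n) ≡ toBit (decide-Starts j (toℕ n) h)
    profile-at h j n = cong (λ jn → toBit (decide-Starts (proj₁ jn) (toℕ (proj₂ jn)) h)) (FP.remQuot-combine {m} {L} j n)

    profileColouring : Colouring w N (2 ^ (m * L))
    profileColouring v p = funToFin (profile (entries v))

    same-profile : ∀ h h' → funToFin (profile h) ≡ funToFin (profile h') → ∀ j n → n < L → Starts j n h → Starts j n h'
    same-profile h h' same j n n<L start =
      subst (λ n → Starts j n h') (FP.toℕ-fromℕ< n<L)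
        (toBit-transfer _ _ same-bit (subst (λ n → Starts j n h) (sym (FP.toℕ-fromℕ< n<L)) start))
      where
      open ≡-Reasoning
      z = combine j (fromℕ< n<L)
      same-bit : toBit (decide-Starts j (toℕ (fromℕ< n<L)) h) ≡ toBit (decide-Starts j (toℕ (fromℕ< n<L)) h')
      same-bit = begin
        toBit (decide-Starts j _ h)    ≡⟨ profile-at h j (fromℕ< n<L) ⟨
        profile h z                     ≡⟨ FP.finToFun-funToFin (profile h) z ⟨
        finToFun (funToFin (profile h)) z   ≡⟨ cong (λ y → finToFun y z) same ⟩
        finToFun (funToFin (profile h')) z  ≡⟨ FP.finToFun-funToFin (profile h') z ⟩
        profile h' z                    ≡⟨ profile-at h' j (fromℕ< n<L) ⟩
        toBit (decide-Starts j _ h')   ∎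

    tightPath : Σ (Fin m) λ j → Σ (ℕ → ℕ) λ P → TightPath c j L P
    tightPath with proj₂ (IH (2 ^ (m * L))) profileColouring
    ... | _ , P , (I , B , W) = j , proj₁ path , proj₁ (proj₂ path)
      where
      j : Fin m
      j = colourOf c P I B
      I₀ = window-increasing I (z<s {1})
      B₀ = window-bounded B (z<s {1})
      I₁ = window-increasing I (n<1+n 1)
      B₁ = window-bounded B (n<1+n 1)
      same : funToFin (profile (entries (tuple w P B₀))) ≡ funToFin (profile (entries (tuple w (P ∘ suc) B₁)))
      same = trans (W 0 z<s I₀ B₀) (sym (W 1 (n<1+n 1) I₁ B₁))
      shift : ∀ n → n < L → Starts j n P → Starts j n (P ∘ suc)
      shift n n<L start =
        Starts-cong j n _ _ (entries-tuple w _ B₁)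
          (same-profile _ _ same j n n<L (Starts-cong j n _ _ (λ a h → sym (entries-tuple w _ B₀ a h)) start))
      grow : ∀ n → Starts j n (P ∘ suc) → Starts j (suc n) P
      grow n start = P w , B w (n<1+n _) , HasColour-cong whole (I , B , refl) , Starts-cong j n _ _ (λ a h → whole (suc a) (s≤s h)) start
        where
        whole : AgreeOn (suc w) P (snoc P (P w))
        whole a a<sw with m≤n⇒m<n∨m≡n (≤-pred a<sw)
        ... | inj₁ a<w  = sym (snoc-< P (P w) a a<w)
        ... | inj₂ refl = sym (snoc-last P (P w))
      starts : ∀ n → n ≤ L → Starts j n P
      starts zero    _    = tt
      starts (suc n) sn≤L = grow n (shift n sn≤L (starts n (<⇒≤ sn≤L)))
      path = Starts⇒tightPath j L P (λ a h → I a (<-trans h (n<1+n _))) (λ a h → B a (<-trans h (n<1+n _))) (starts L ≤-refl)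

tightPathBound-2 : ∀ u m → TightPathBound u m 2
tightPathBound-2 zero    m = tightPathBound-base m
tightPathBound-2 (suc u) m = TightPathStep.N u (tightPathBound-2 u) m 2 , TightPathStep.WithColouring.tightPath u (tightPathBound-2 u) m 2

tightPathBound : ∀ u m L → TightPathBound (suc u) m L
tightPathBound u m L = TightPathStep.N u (tightPathBound-2 u) m L , TightPathStep.WithColouring.tightPath u (tightPathBound-2 u) m L

Searchable : Set → Set₁
Searchable A = ∀ {P : A → Set} → (∀ a → Dec (P a)) → Dec (Σ A P)

search-Fin : ∀ {n} → Searchable (Fin n)
search-Fin = FP.any?

search-Vec : ∀ {A} → Searchable A → ∀ {n} → Searchable (Vec A n)
search-Vec sA {zero} P? with P? []
... | yes p = yes ([] , p)
... | no ¬p = no λ { ([] , p) → ¬p p }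
search-Vec sA {suc n} P? with sA (λ a → search-Vec sA {n} (λ v → P? (a ∷ v)))
... | yes (a , v , p) = yes (a ∷ v , p)
... | no ¬p           = no λ { (a ∷ v , p) → ¬p (a , v , p) }

decide-∀ : ∀ {A} → Searchable A → ∀ {P : A → Set} → (∀ a → Dec (P a)) → Dec (∀ a → P a)
decide-∀ sA P? with sA (λ a → ¬? (P? a))
... | yes (a , ¬p) = no λ all → ¬p (all a)
... | no ¬some     = yes λ a → decidable-stable (P? a) (λ ¬p → ¬some (a , ¬p))

DecidableEdges : ∀ {k} → OrdHypergraph k → Set
DecidableEdges {k} G = ∀ v → Dec (Edge G v)

path-edges? : ∀ k ℓ e → DecidableEdges (Path k ℓ e)
path-edges? k ℓ e v = anyUpTo? (λ r → VP.≡-dec _≟_ (map toℕ v) (tabulate (λ a → r * (k ∸ ℓ) + toℕ a))) e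

increasing? : ∀ {N K} (v : Vec (Fin N) K) → Dec (Increasing v)
increasing? v = linked? FP._<?_ v

module _ {k N t : ℕ} (G : OrdHypergraph k) (edge? : DecidableEdges G) (c : Colouring k N t) (j : Fin t) where
  private
    m = nV G

  colour-is? : ∀ (u : Vec (Fin N) k) → Dec (∀ (p : Increasing u) → c u p ≡ j)
  colour-is? u with increasing? u
  ... | no ¬p = yes λ p → ⊥-elim (¬p p)
  ... | yes p with c u p FP.≟ j
  ...   | yes same = yes λ p' → trans (colour-resp c refl p' p) same
  ...   | no ¬same = no λ all → ¬same (all p)

  contained? : Dec (ContainedInColour G c j)
  contained? with search-Vec search-Fin (λ (F : Vec (Fin N) m) → mono? (lookup F) ×-dec coloured? (lookup F))
    where
    mono? : ∀ F → Dec (∀ a b → a <ᶠ b → F a <ᶠ F b)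
    mono? F = decide-∀ search-Fin λ a → decide-∀ search-Fin λ b → (a FP.<? b) →-dec (F a FP.<? F b)
    coloured? : ∀ F → Dec (∀ (v : Vec (Fin m) k) → Edge G v → ∀ p → c (map F v) p ≡ j)
    coloured? F = decide-∀ (search-Vec search-Fin) λ v → edge? v →-dec colour-is? (map F v)
  ... | yes (F , mono , coloured) = yes ((lookup F , mono) , coloured)
  ... | no ¬some = no λ { ((F , mono) , coloured) → ¬some (tabulate F ,
          (λ a b a<b → subst₂ _<ᶠ_ (sym (VP.lookup∘tabulate F a)) (sym (VP.lookup∘tabulate F b)) (mono a b a<b)) ,
          λ v e p → let same = VP.map-cong (VP.lookup∘tabulate F) v in
             trans (colour-resp c same p (subst Increasing same p)) (coloured v e _)) }

-- Colourings of the k-subsets of [M] with colours Fin (suc t), tabulated as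
-- nested vectors so that all of them can be searched.
module ColouringTable (M t : ℕ) where
  Table : ℕ → Set
  Table zero    = Fin (suc t)
  Table (suc n) = Vec (Table n) M

  search-Table : ∀ n → Searchable (Table n)
  search-Table zero    = search-Fin
  search-Table (suc n) = search-Vec (search-Table n)

  read : ∀ {n} → Table n → Vec (Fin M) n → Fin (suc t)
  read {zero}  x  []      = x
  read {suc n} xs (a ∷ v) = read (lookup xs a) v

  write : ∀ {n} → (Vec (Fin M) n → Fin (suc t)) → Table n
  write {zero}  f = f []
  write {suc n} f = tabulate λ a → write (λ v → f (a ∷ v))

  read-write : ∀ {n} (f : Vec (Fin M) n → Fin (suc t)) v → read (write f) v ≡ f v
  read-write {zero}  f []      = refl
  read-write {suc n} f (a ∷ v) =
    trans (cong (λ x → read x v) (VP.lookup∘tabulate _ a)) (read-write (λ v → f (a ∷ v)) v)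

  colouring : ∀ {n} → Table n → Colouring n M (suc t)
  colouring x v p = read x v

  total : ∀ {n} → Colouring n M (suc t) → Vec (Fin M) n → Fin (suc t)
  total c v with increasing? v
  ... | yes p = c v p
  ... | no _  = fzero

  table-colouring : ∀ {n} (c : Colouring n M (suc t)) v p → colouring (write (total c)) v p ≡ c v p
  table-colouring c v p with read-write (total c) v
  ... | same with increasing? v
  ...   | yes p' = trans same (colour-resp c refl p' p)
  ...   | no ¬p  = ⊥-elim (¬p p)

arrows? : ∀ {k t} M (Gs : Fin t → OrdHypergraph k) → (∀ j → DecidableEdges (Gs j)) → Dec (Arrows M Gs)
arrows? {k} {zero} M Gs edges? with search-Vec search-Fin {k} (increasing? {M} {k})
... | yes (v , p)       = yes λ c → ⊥-elim (FP.¬Fin0 (c v p))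
... | no ¬some-increasing = no λ arrows → FP.¬Fin0 (proj₁ (arrows λ v p → ⊥-elim (¬some-increasing (v , p))))
arrows? {k} {suc t} M Gs edges?
  with decide-∀ (search-Table k) (λ x → search-Fin (λ j → contained? (Gs j) (edges? j) (colouring x) j))
  where open ColouringTable M t
... | yes all = yes λ c → let (j , contained) = all (write (total c)) in
      j , (proj₁ contained , λ v e p → trans (sym (table-colouring c _ p)) (proj₂ contained v e p))
  where open ColouringTable M t
... | no ¬all = no λ arrows → ¬all λ x → arrows (colouring x)
  where open ColouringTable M t

least : ∀ {P : ℕ → Set} → (∀ n → Dec (P n)) → ∀ B → P B → Σ ℕ λ N → P N × (∀ M → P M → N ≤ M)
least {P} P? = <-rec (λ B → P B → Σ ℕ λ N → P N × (∀ M → P M → N ≤ M)) step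
  where
  step : ∀ B → (∀ {m} → m < B → P m → Σ ℕ λ N → P N × (∀ M → P M → N ≤ M)) → P B → Σ ℕ λ N → P N × (∀ M → P M → N ≤ M)
  step B smaller pB with anyUpTo? P? B
  ... | yes (m , m<B , pm) = smaller m<B pm
  ... | no ¬below          = B , pB , λ M pM → ≮⇒≥ λ M<B → ¬below (M , M<B , pM)

ramseyNumber : ∀ {k t} (Gs : Fin t → OrdHypergraph k) → (∀ j → DecidableEdges (Gs j)) →
  ∀ B → Arrows B Gs → Σ ℕ (IsOrderedRamseyNumber Gs)
ramseyNumber Gs edges? B arrows with least (λ M → arrows? M Gs edges?) B arrows
... | N , arrowsN , minimal = N , arrowsN , minimal

module Rescaling (d : ℕ) .{{_ : NonZero d}} where

  -- Blow-up: every vertex x becomes the block x*d, ..., x*d + d - 1.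
  blow : (ℕ → ℕ) → ℕ → ℕ
  blow f a = f (a / d) * d + a % d

  shrink : (ℕ → ℕ) → ℕ → ℕ
  shrink g m = g (m * d) / d

  divide : ∀ a → a ≡ a % d + (a / d) * d
  divide a = m≡m%n+[m/n]*n a d

  /-shift : ∀ r a → (r * d + a) / d ≡ r + a / d
  /-shift r a = trans (+-distrib-/-∣ˡ a (n∣m*n r)) (cong (_+ a / d) (m*n/n≡m r d))

  %-shift : ∀ r a → (r * d + a) % d ≡ a % d
  %-shift r a = trans (cong (_% d) (+-comm (r * d) a)) ([m+kn]%n≡m%n a r d)

  blow-shift : ∀ f r a → blow f (r * d + a) ≡ blow (λ b → f (r + b)) a
  blow-shift f r a = cong₂ _+_ (cong (λ z → f z * d) (/-shift r a)) (%-shift r a)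

  shrink-shift : ∀ g r a → shrink g (r + a) ≡ shrink (λ b → g (r * d + b)) a
  shrink-shift g r a = cong (λ z → g z / d) (*-distribʳ-+ d r a)

  blow-cong : ∀ n {f g} → AgreeOn n f g → AgreeOn (n * d) (blow f) (blow g)
  blow-cong n f≈g a a<nd = cong (λ z → z * d + a % d) (f≈g (a / d) (m<n*o⇒m/o<n a<nd))

  block-< : ∀ {x y} i i' → x < y → i < d → x * d + i < y * d + i'
  block-< {x} {y} i i' x<y i<d = begin-strict
    x * d + i   <⟨ +-monoʳ-< (x * d) i<d ⟩
    x * d + d   ≡⟨ +-comm (x * d) d ⟩
    suc x * d   ≤⟨ *-monoˡ-≤ d x<y ⟩
    y * d       ≤⟨ m≤m+n (y * d) i' ⟩
    y * d + i'  ∎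
    where open ≤-Reasoning

  blow-< : ∀ n f → IncreasingOn n f → ∀ a b → a < b → b / d < n → blow f a < blow f b
  blow-< n f I a b a<b b/d<n with m≤n⇒m<n∨m≡n (/-monoˡ-≤ d (<⇒≤ a<b))
  ... | inj₁ a/d<b/d = block-< (a % d) (b % d) (increasing-< I (a / d) (b / d) a/d<b/d b/d<n) (m%n<n a d)
  ... | inj₂ same    = subst (λ z → blow f a < f z * d + b % d) same (+-monoʳ-< (f (a / d) * d) a%d<b%d)
    where
    a%d<b%d : a % d < b % d
    a%d<b%d = +-cancelʳ-< ((a / d) * d) (a % d) (b % d)
      (subst₂ _<_ (divide a) (trans (divide b) (cong (λ z → b % d + z * d) (sym same))) a<b)

  blow-increasing : ∀ n K f → IncreasingOn n f → K ≤ n * d → IncreasingOn K (blow f)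
  blow-increasing n K f I K≤nd a h = blow-< n f I a (suc a) (n<1+n a) (m<n*o⇒m/o<n (<-≤-trans h K≤nd))

  blow-bounded : ∀ s → s ≤ d → ∀ n f R → IncreasingOn (suc n) f → BoundedOn (suc n) (suc R) f →
    BoundedOn (n * d + s) (R * d + s) (blow f)
  blow-bounded s s≤d n f R I B a a<nd+s with m≤n⇒m<n∨m≡n (≤-pred (m<n*o⇒m/o<n {o = d} a<sn*d))
    where
    a<sn*d : a < suc n * d
    a<sn*d = <-≤-trans a<nd+s (≤-trans (+-monoʳ-≤ (n * d) s≤d) (≤-reflexive (+-comm (n * d) d)))
  ... | inj₁ a/d<n = block-< (a % d) s (<-≤-trans (increasing-< I (a / d) n a/d<n (n<1+n n)) (≤-pred (B n (n<1+n n)))) (m%n<n a d)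
  ... | inj₂ a/d≡n = +-mono-≤-< (*-monoˡ-≤ d (≤-pred (B (a / d) (s≤s (≤-reflexive a/d≡n))))) a%d<s
    where
    a%d<s : a % d < s
    a%d<s = +-cancelʳ-< (n * d) (a % d) s
      (subst₂ _<_ (trans (divide a) (cong (λ z → a % d + z * d) a/d≡n)) (+-comm (n * d) s) a<nd+s)

  shrink-increasing : ∀ n K g → IncreasingOn K g → n * d < K → IncreasingOn (suc n) (shrink g)
  shrink-increasing n K g I nd<K m (s≤s m<n) = begin-strict
    g (m * d) / d             <⟨ n<1+n _ ⟩
    suc (g (m * d) / d)       ≡⟨ /-shift 1 (g (m * d)) ⟨
    (1 * d + g (m * d)) / d   ≡⟨ cong (_/ d) (trans (cong (_+ g (m * d)) (*-identityˡ d)) (+-comm d (g (m * d)))) ⟩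
    (g (m * d) + d) / d       ≤⟨ /-monoˡ-≤ d (increasing-gap I (m * d) d md+d<K) ⟩
    g (m * d + d) / d         ≡⟨ cong (λ z → g z / d) (+-comm (m * d) d) ⟩
    g (suc m * d) / d         ∎
    where
    open ≤-Reasoning
    md+d<K : m * d + d < K
    md+d<K = ≤-<-trans (≤-trans (≤-reflexive (+-comm (m * d) d)) (*-monoˡ-≤ d m<n)) nd<K

  -- Shrinking K = n*d + s increasing vertices of [M] (s ≥ 1) lands in
  -- [(M - s)/d + 1]: the vertex at n*d is followed by s - 1 more below M.
  shrink-bounded : ∀ s → 1 ≤ s → ∀ n K M g → IncreasingOn K g → BoundedOn K M g → K ≡ n * d + s →
    BoundedOn (suc n) (suc ((M ∸ s) / d)) (shrink g)
  shrink-bounded (suc s') _ n K M g I B K≡ m (s≤s m≤n) =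
    s≤s (/-monoˡ-≤ d (≤-trans (increasing-≤ I (m * d) (n * d) (*-monoˡ-≤ d m≤n) nd<K) last≤))
    where
    last<K : n * d + s' < K
    last<K = subst (n * d + s' <_) (sym K≡) (≤-reflexive (sym (+-suc (n * d) s')))
    nd<K : n * d < K
    nd<K = ≤-<-trans (m≤m+n (n * d) s') last<K
    last≤ : g (n * d) ≤ M ∸ suc s'
    last≤ = ≤-trans (≤-reflexive (sym (m+n∸n≡m (g (n * d)) (suc s'))))
      (∸-monoˡ-≤ (suc s') (≤-trans (≤-reflexive (+-suc (g (n * d)) s'))
        (<-≤-trans (s≤s (increasing-gap I (n * d) s' last<K)) (B (n * d + s') last<K))))

module Reduction (k ℓ w s : ℕ) .{{_ : NonZero (k ∸ ℓ)}} (ℓ≤k : ℓ ≤ k) (1≤s : 1 ≤ s) (s≤d : s ≤ k ∸ ℓ)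
                 (k≡ : k ≡ w * (k ∸ ℓ) + s) where
  d : ℕ
  d = k ∸ ℓ
  open Rescaling d

  k≤blocks : k ≤ suc w * d
  k≤blocks = subst (_≤ suc w * d) (sym k≡) (≤-trans (+-monoʳ-≤ (w * d) s≤d) (≤-reflexive (+-comm (w * d) d)))

  wd<k : w * d < k
  wd<k = subst (w * d <_) (sym k≡) (≤-trans (≤-reflexive (+-comm 1 (w * d))) (+-monoʳ-≤ (w * d) 1≤s))

  path-size : ∀ e' → suc e' * d + ℓ ≡ (e' + w) * d + s
  path-size e' = begin
    suc e' * d + ℓ       ≡⟨ +-assoc d (e' * d) ℓ ⟩
    d + (e' * d + ℓ)     ≡⟨ cong (d +_) (+-comm (e' * d) ℓ) ⟩
    d + (ℓ + e' * d)     ≡⟨ +-assoc d ℓ (e' * d) ⟨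
    d + ℓ + e' * d       ≡⟨ cong (_+ e' * d) (m∸n+n≡m ℓ≤k) ⟩
    k + e' * d           ≡⟨ cong (_+ e' * d) k≡ ⟩
    w * d + s + e' * d   ≡⟨ solve 3 (λ w s e → w :+ s :+ e := e :+ w :+ s) refl (w * d) s (e' * d) ⟩
    e' * d + w * d + s   ≡⟨ cong (_+ s) (*-distribʳ-+ d e' w) ⟨
    (e' + w) * d + s     ∎
    where
    open ≡-Reasoning
    open +-*-Solver using (solve; _:=_; _:+_)

  blowColouring : ∀ {t} R → Colouring k (R * d + s) t → Colouring (suc w) (suc R) t
  blowColouring R c v p =
    colourOf c (blow (entries v)) (blow-increasing (suc w) k _ (entries-increasing p) k≤blocks)
      (subst (λ n → BoundedOn n (R * d + s) (blow (entries v))) (sym k≡)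
        (blow-bounded s s≤d w (entries v) R (entries-increasing p) (entries-bounded v)))

  blowColouring-colourOf : ∀ {t} R (c : Colouring k (R * d + s) t) f I B p q →
    colourOf (blowColouring R c) f I B ≡ colourOf c (blow f) p q
  blowColouring-colourOf R c f I B p q =
    colourOf-cong c _ _ _ _ p q (λ a a<k → blow-cong (suc w) (entries-tuple (suc w) f B) a (<-≤-trans a<k k≤blocks))

  shrinkColouring : ∀ {t} M → Colouring (suc w) (suc ((M ∸ s) / d)) t → Colouring k M t
  shrinkColouring M c v p =
    colourOf c (shrink (entries v)) (shrink-increasing w k _ (entries-increasing p) wd<k)
      (shrink-bounded s 1≤s w k M _ (entries-increasing p) (entries-bounded v) k≡)

  shrinkColouring-colourOf : ∀ {t} M (c : Colouring (suc w) (suc ((M ∸ s) / d)) t) f I B p q →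
    colourOf (shrinkColouring M c) f I B ≡ colourOf c (shrink f) p q
  shrinkColouring-colourOf M c f I B p q =
    colourOf-cong c _ _ _ _ p q (λ a a≤w → cong (_/ d) (entries-tuple k f B (a * d) (≤-<-trans (*-monoˡ-≤ d (≤-pred a≤w)) wd<k)))

  blow-path : ∀ {t} R (c : Colouring k (R * d + s) t) j e' P →
    TightPath (blowColouring R c) j (suc e') P → MonoPath c j ℓ (suc e') (blow P)
  blow-path R c j e' P (I , B , W) = increasing , bounded , window
    where
    fits : suc e' * d + ℓ ≤ suc (e' + w) * d
    fits = subst (_≤ suc (e' + w) * d) (sym (path-size e'))
      (≤-trans (+-monoʳ-≤ ((e' + w) * d) s≤d) (≤-reflexive (+-comm ((e' + w) * d) d)))
    increasing : IncreasingOn (suc e' * d + ℓ) (blow P)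
    increasing = blow-increasing (suc (e' + w)) _ P I fits
    bounded : BoundedOn (suc e' * d + ℓ) (R * d + s) (blow P)
    bounded = subst (λ n → BoundedOn n (R * d + s) (blow P)) (sym (path-size e')) (blow-bounded s s≤d (e' + w) P R I B)
    window : ∀ r → r < suc e' → ∀ p q → colourOf c (λ a → blow P (r * d + a)) p q ≡ j
    window r r<e p q =
      trans (colourOf-cong c _ _ p q p' q' shifted)
        (trans (sym (blowColouring-colourOf R c _ (window-increasing I r<e) (window-bounded B r<e) p' q')) (W r r<e _ _))
      where
      shifted : AgreeOn k (λ a → blow P (r * d + a)) (blow (λ b → P (r + b)))
      shifted a _ = blow-shift P r a
      p' = increasing-cong shifted p
      q' = bounded-cong shifted q

  shrink-path : ∀ {t} M (c : Colouring (suc w) (suc ((M ∸ s) / d)) t) j e' g →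
    MonoPath (shrinkColouring M c) j ℓ (suc e') g → TightPath c j (suc e') (shrink g)
  shrink-path M c j e' g (I , B , W) = increasing , bounded , window
    where
    fits : (e' + w) * d < suc e' * d + ℓ
    fits = subst ((e' + w) * d <_) (sym (path-size e'))
      (≤-trans (≤-reflexive (+-comm 1 _)) (+-monoʳ-≤ ((e' + w) * d) 1≤s))
    increasing : IncreasingOn (suc e' + w) (shrink g)
    increasing = shrink-increasing (e' + w) _ g I fits
    bounded : BoundedOn (suc e' + w) (suc ((M ∸ s) / d)) (shrink g)
    bounded = shrink-bounded s 1≤s (e' + w) _ M g I B (path-size e')
    window : ∀ r → r < suc e' → ∀ p q → colourOf c (λ a → shrink g (r + a)) p q ≡ j
    window r r<e p q =
      trans (colourOf-cong c _ _ p q p' q' shifted)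
        (trans (sym (shrinkColouring-colourOf M c _ Ir Br p' q')) (W r r<e Ir Br))
      where
      shifted : AgreeOn (suc w) (λ a → shrink g (r + a)) (shrink (λ b → g (r * d + b)))
      shifted a _ = shrink-shift g r a
      p' = increasing-cong shifted p
      q' = bounded-cong shifted q
      Ir = shift-increasing (r * d) k I (edge-fits ℓ≤k r<e)
      Br = shift-bounded (r * d) k B (edge-fits ℓ≤k r<e)

  upper : ∀ {t} (es : Fin t → ℕ) → (∀ j → 1 ≤ es j) → ∀ R →
    Arrows (suc R) (λ j → Path (suc w) w (es j)) → Arrows (R * d + s) (λ j → Path k ℓ (es j))
  upper es es≥1 R arrows c = j , transfer (es j) (es≥1 j) contained
    where
    j = proj₁ (arrows (blowColouring R c))
    contained = proj₂ (arrows (blowColouring R c))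
    transfer : ∀ e → 1 ≤ e → ContainedInColour (Path (suc w) w e) (blowColouring R c) j → ContainedInColour (Path k ℓ e) c j
    transfer (suc e') _ contained =
      let (P , mono) = contained⇒monoPath (blowColouring R c) j w (suc e') (n≤1+n w) contained in
      monoPath⇒contained c j ℓ (suc e') (blow P) (blow-path R c j e' P (monoPath⇒tightPath (blowColouring R c) j (suc e') P mono))

  lower : ∀ {t} (es : Fin t → ℕ) → (∀ j → 1 ≤ es j) → ∀ M →
    Arrows M (λ j → Path k ℓ (es j)) → Arrows (suc ((M ∸ s) / d)) (λ j → Path (suc w) w (es j))
  lower es es≥1 M arrows c = j , transfer (es j) (es≥1 j) contained
    where
    j = proj₁ (arrows (shrinkColouring M c))
    contained = proj₂ (arrows (shrinkColouring M c))
    transfer : ∀ e → 1 ≤ e → ContainedInColour (Path k ℓ e) (shrinkColouring M c) j → ContainedInColour (Path (suc w) w e) c j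
    transfer (suc e') _ contained =
      let (g , mono) = contained⇒monoPath (shrinkColouring M c) j ℓ (suc e') ℓ≤k contained in
      monoPath⇒contained c j w (suc e') (shrink g) (tightPath⇒monoPath c j (suc e') (shrink g) (shrink-path M c j e' g mono))

  ramsey-correspondence : ∀ {t} (es : Fin t → ℕ) (es≥1 : ∀ j → 1 ≤ es j) R →
    IsOrderedRamseyNumber (λ j → Path (suc w) w (es j)) (suc R) →
    IsOrderedRamseyNumber (λ j → Path k ℓ (es j)) (R * d + s)
  ramsey-correspondence es es≥1 R (arrows , minimal) = upper es es≥1 R arrows , least-arrowing
    where
    least-arrowing : ∀ M → Arrows M (λ j → Path k ℓ (es j)) → R * d + s ≤ M
    least-arrowing M arrowsM = begin
      R * d + s               ≤⟨ +-monoˡ-≤ s (*-monoˡ-≤ d (s≤s⁻¹ (minimal _ (lower es es≥1 M arrowsM)))) ⟩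
      ((M ∸ s) / d) * d + s   ≤⟨ +-monoˡ-≤ s (m/n*n≤m (M ∸ s) d) ⟩
      M ∸ s + s               ≡⟨ m∸n+n≡m s≤M ⟩
      M                       ∎
      where
      open ≤-Reasoning
      s≤M : s ≤ M
      s≤M = ≤-trans (subst (s ≤_) (sym k≡) (m≤n+m s (w * d)))
                    (arrows-size M _ (λ j → edge-fits ℓ≤k (es≥1 j)) arrowsM)

intersection-blocks : ∀ k ℓ u → ℓ ≤ k → IsIntersectionNumber k ℓ (suc (suc u)) →
  suc u * (k ∸ ℓ) < k × k ≤ suc (suc u) * (k ∸ ℓ)
intersection-blocks k ℓ u ℓ≤k (_ , below , above) = wd<k , k≤[w+1]d
  where
  d = k ∸ ℓ
  w = suc u
  ℓ+d≡k : ℓ + d ≡ k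
  ℓ+d≡k = m+[n∸m]≡n ℓ≤k
  split : ∀ a → a * k ≡ a * ℓ + a * d
  split a = trans (cong (a *_) (sym ℓ+d≡k)) (*-distribˡ-+ a ℓ d)
  ℓ*suc : ∀ a → ℓ * suc a ≡ a * ℓ + ℓ
  ℓ*suc a = trans (*-suc ℓ a) (trans (+-comm ℓ (ℓ * a)) (cong (_+ ℓ) (*-comm ℓ a)))
  ud<ℓ : u * d < ℓ
  ud<ℓ = +-cancelˡ-< (u * ℓ) (u * d) ℓ (subst₂ _<_ (split u) (ℓ*suc u) below)
  ℓ≤wd : ℓ ≤ w * d
  ℓ≤wd = +-cancelˡ-≤ (w * ℓ) ℓ (w * d) (subst₂ _≤_ (ℓ*suc w) (split w) above)
  wd<k : w * d < k
  wd<k = subst (w * d <_) (trans (+-comm d ℓ) ℓ+d≡k) (+-monoʳ-< d ud<ℓ)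
  k≤[w+1]d : k ≤ suc w * d
  k≤[w+1]d = subst (_≤ suc w * d) ℓ+d≡k (≤-trans (+-monoˡ-≤ d ℓ≤wd) (≤-reflexive (+-comm (w * d) d)))

-- The value of the formula of the theorem when R_< of the tight paths is R + 1.
ramsey-formula : ∀ d ℓ k w s R → ℓ + d ≡ k → k ≡ w * d + s → d * suc R + ℓ ∸ d * w ≡ R * d + s
ramsey-formula d ℓ k w s R ℓ+d≡k k≡ = trans (cong (_∸ d * w) expand) (m+n∸n≡m (R * d + s) (d * w))
  where
  open +-*-Solver using (solve; _:=_; _:+_; _:*_; con)
  expand : d * suc R + ℓ ≡ R * d + s + d * w
  expand = begin
    d * suc R + ℓ         ≡⟨ solve 3 (λ d R l → d :* (con 1 :+ R) :+ l := d :* R :+ (l :+ d)) refl d R ℓ ⟩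
    d * R + (ℓ + d)       ≡⟨ cong (d * R +_) (trans ℓ+d≡k k≡) ⟩
    d * R + (w * d + s)   ≡⟨ solve 4 (λ d R w s → d :* R :+ (w :* d :+ s) := R :* d :+ s :+ d :* w) refl d R w s ⟩
    R * d + s + d * w     ∎
    where open ≡-Reasoning

-- Sum of the path lengths, to find one length bounding all of them.
sum : ∀ {t} → (Fin t → ℕ) → ℕ
sum {zero}  es = 0
sum {suc t} es = es fzero + sum (es ∘ fsuc)

≤-sum : ∀ {t} (es : Fin t → ℕ) j → es j ≤ sum es
≤-sum es fzero    = m≤m+n _ _
≤-sum es (fsuc j) = ≤-trans (≤-sum (es ∘ fsuc) j) (m≤n+m _ _)

tightPaths-arrow : ∀ u {t} (es : Fin t → ℕ) → Σ ℕ λ B → Arrows B (λ j → Path (suc (suc u)) (suc u) (es j))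
tightPaths-arrow u {t} es = proj₁ bound , path
  where
  bound = tightPathBound u t (sum es)
  path : Arrows (proj₁ bound) (λ j → Path (suc (suc u)) (suc u) (es j))
  path c with proj₂ bound c
  ... | j , P , tight = j , monoPath⇒contained c j (suc u) (es j) P
          (tightPath⇒monoPath c j (es j) P (tightPath-prefix c j (es j) (sum es) P (≤-sum es j) tight))

-- The Ramsey number of the tight paths P^{i,i-1} exists and is positive (an
-- edge needs i vertices), say R + 1; with k = (i-1)(k-ℓ) + s the reduction
-- gives R (k-ℓ) + s for the paths P^{k,ℓ}, which is the stated value.
theorem1 : (k ℓ i t : ℕ) → ℓ < k → 1 ≤ ℓ → IsIntersectionNumber k ℓ i →
    (es : Fin t → ℕ) → (∀ j → 1 ≤ es j) →
    Σ ℕ λ N →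
    IsOrderedRamseyNumber (λ j → Path i (i ∸ 1) (es j)) N ×
    IsOrderedRamseyNumber (λ j → Path k ℓ (es j))
    ((k ∸ ℓ) * N + ℓ ∸ (k ∸ ℓ) * (i ∸ 1))
theorem1 k ℓ (suc (suc u)) t ℓ<k _ isInt@(s≤s (s≤s z≤n) , _) es es≥1
  with ramseyNumber tight (λ j → path-edges? _ _ _) _ (proj₂ (tightPaths-arrow u es))
  where
  tight = λ j → Path (suc (suc u)) (suc u) (es j)
... | zero , arrows , _ = ⊥-elim (<⇒≱ z<s (arrows-size 0 _ (λ j → edge-fits (n≤1+n _) (es≥1 j)) arrows))
... | suc R , ramseyR =
  suc R , ramseyR ,
  subst (IsOrderedRamseyNumber (λ j → Path k ℓ (es j))) (sym (ramsey-formula d ℓ k w s R ℓ+d≡k k≡))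
    (ramsey-correspondence es es≥1 R ramseyR)
  where
  d = k ∸ ℓ
  w = suc u
  s = k ∸ w * d
  ℓ+d≡k = m+[n∸m]≡n (<⇒≤ ℓ<k)
  blocks = intersection-blocks k ℓ u (<⇒≤ ℓ<k) isInt
  k≡ = sym (m+[n∸m]≡n (<⇒≤ (proj₁ blocks)))
  instance
    d-nonZero : NonZero d
    d-nonZero = >-nonZero (m<n⇒0<n∸m ℓ<k)
  s≤d : s ≤ d
  s≤d = m≤n+o⇒m∸n≤o k (w * d) (subst (k ≤_) (+-comm d (w * d)) (proj₂ blocks))
  open Reduction k ℓ w s (<⇒≤ ℓ<k) (m<n⇒0<n∸m (proj₁ blocks)) s≤d k≡ using (ramsey-correspondence)
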